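{- Let $G$ be a connected graph on $p\geq 3$ vertices. If $u$ and $v$ are any two adjacent vertices of the central graph $C[G]$, then there is a third vertex $w$ of $C[G]$, distinct from $u$ and $v$, that is adjacent to neither $u$ nor $v$.
   Context: Graphs are finite, simple and undirected. The central graph $C[G]$ of a graph $G$ has vertex set $V(G)\cup I(G)$, where $I(G)=\{w_e:e\in E(G)\}$ contains one new vertex for each edge of $G$; its edges are $uw_e$ for each edge $e$ of $G$ and each endpoint $u$ of $e$, and $uv$ for every pair of distinct vertices $u,v\in V(G)$ nonadjacent in $G$ (the original edges of $G$ are not edges of $C[G]$). -}

module Defs where

open import Data.Nat using (ℕ)
open import Data.Fin using (Fin; _<_)
open import Data.Bool using (Bool; true; false; T)
open import Data.Product using (Σ; _×_; _,_; proj₁; proj₂)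
open import Data.Sum using (_⊎_; inj₁; inj₂)
open import Data.Empty using (⊥)
open import Relation.Nullary using (¬_)
open import Relation.Binary.PropositionalEquality using (_≡_; _≢_)
open import Relation.Binary.Construct.Closure.ReflexiveTransitive using (Star)

record Graph (n : ℕ) : Set where
  field
    edge  : Fin n → Fin n → Bool
    sym   : ∀ u v → edge u v ≡ edge v u
    irrefl : ∀ u → edge u u ≡ false

  Adj : Fin n → Fin n → Set
  Adj u v = T (edge u v)

  -- Edges of G, each unordered edge {u,v} represented once as (u , v) with u < v.
  Edge : Set
  Edge = Σ (Fin n) λ u → Σ (Fin n) λ v → u < v × Adj u v

  _∈ₑ_ : Fin n → Edge → Set
  x ∈ₑ (u , v , _) = (x ≡ u) ⊎ (x ≡ v)

open Graph public

Connected : ∀ {n} → Graph n → Set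
Connected G = ∀ u v → Star (Adj G) u v

-- Vertex set of the central graph C[G]: V(G) ∪ I(G), one new vertex w_e per edge e.
CVertex : ∀ {n} → Graph n → Set
CVertex {n} G = Fin n ⊎ Edge G

CAdj : ∀ {n} (G : Graph n) → CVertex G → CVertex G → Set
CAdj G (inj₁ u) (inj₁ v) = u ≢ v × ¬ Adj G u v
CAdj G (inj₁ u) (inj₂ e) = _∈ₑ_ G u e
CAdj G (inj₂ e) (inj₁ u) = _∈ₑ_ G u e
CAdj G (inj₂ e) (inj₂ f) = ⊥

{-# OPTIONS --safe #-}
module Submission where

open import Defs
open import Data.Nat using (ℕ; _≥_; s≤s)
open import Data.Fin using (Fin; zero; suc; _≟_)
open import Data.Fin.Properties using (<-cmp)
open import Data.Product using (Σ; _×_; _,_)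
open import Data.Sum using (inj₁; inj₂; [_,_])
open import Data.Bool using (T)
open import Data.Empty using (⊥-elim)
open import Relation.Binary using (tri<; tri≈; tri>)
open import Relation.Binary.PropositionalEquality using (_≡_; _≢_; refl; subst; ≢-sym)
open import Relation.Binary.Construct.Closure.ReflexiveTransitive using (Star; ε; _◅_)
open import Relation.Nullary using (¬_; yes; no)

-- If u, v ∈ V(G) are nonadjacent in G, walk from u to v in G:
-- after the first step the walk is at a neighbour a of u; its next step either
-- returns to u, reaches v (so a is a common G-neighbour of u and v), or runs
-- along an edge f missing both u and v (so w_f works). If u is an endpoint of e,
-- pick a vertex c outside e (here p ≥ 3 is used) and look at the first step
-- c — d of a walk from c to u: either d = u and c works, or w_{cd} works.

fresh : ∀ {n} → n ≥ 3 → (a b : Fin n) → Σ (Fin n) λ c → c ≢ a × c ≢ b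
fresh (s≤s (s≤s (s≤s _))) a b with zero ≟ a | zero ≟ b
... | no 0≢a | no 0≢b = zero , 0≢a , 0≢b
... | yes refl | _ with suc zero ≟ b
...   | no 1≢b = suc zero , (λ ()) , 1≢b
...   | yes refl = suc (suc zero) , (λ ()) , (λ ())
fresh (s≤s (s≤s (s≤s _))) a b | no _ | yes refl with suc zero ≟ a
...   | no 1≢a = suc zero , 1≢a , (λ ())
...   | yes refl = suc (suc zero) , (λ ()) , (λ ())

module _ {p : ℕ} (G : Graph p) where
  open Graph G using () renaming (Adj to _~_; _∈ₑ_ to _∈_)

  ~-irrefl : ∀ {x y} → x ~ y → x ≢ y
  ~-irrefl {x} x~x refl = subst T (irrefl G x) x~x

  ~-sym : ∀ {x y} → x ~ y → y ~ x
  ~-sym {x} {y} = subst T (Graph.sym G x y)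

  toEdge : ∀ {x y} → x ~ y → Edge G
  toEdge {x} {y} x~y with <-cmp x y
  ... | tri< x<y _ _ = x , y , x<y , x~y
  ... | tri≈ _ x≡y _ = ⊥-elim (~-irrefl x~y x≡y)
  ... | tri> _ _ y<x = y , x , y<x , ~-sym x~y

  ∉-toEdge : ∀ {x y z} (x~y : x ~ y) → z ≢ x → z ≢ y → ¬ z ∈ toEdge x~y
  ∉-toEdge {x} {y} x~y z≢x z≢y with <-cmp x y
  ... | tri< _ _ _ = [ z≢x , z≢y ]
  ... | tri≈ _ x≡y _ = ⊥-elim (~-irrefl x~y x≡y)
  ... | tri> _ _ _ = [ z≢y , z≢x ]

  outside : p ≥ 3 → (e : Edge G) → Σ (Fin p) λ c → ¬ c ∈ e
  outside p≥3 (x , y , _) with fresh p≥3 x y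
  ... | c , c≢x , c≢y = c , [ c≢x , c≢y ]

  CommonNonNeighbour : CVertex G → CVertex G → Set
  CommonNonNeighbour u v =
    Σ (CVertex G) λ w → w ≢ u × w ≢ v × ¬ CAdj G u w × ¬ CAdj G v w

  commonNonNeighbour-sym : ∀ {u v} → CommonNonNeighbour u v → CommonNonNeighbour v u
  commonNonNeighbour-sym (w , w≢u , w≢v , u≁w , v≁w) = w , w≢v , w≢u , v≁w , u≁w

  commonNeighbour⇒commonNonNeighbour : ∀ {u v x} → u ~ x → v ~ x →
    CommonNonNeighbour (inj₁ u) (inj₁ v)
  commonNeighbour⇒commonNonNeighbour {x = x} u~x v~x =
    inj₁ x , (λ { refl → ~-irrefl u~x refl }) , (λ { refl → ~-irrefl v~x refl }) ,
    (λ (_ , u≁x) → u≁x u~x) , (λ (_ , v≁x) → v≁x v~x)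

  disjointEdge⇒commonNonNeighbour : ∀ {u v} f → ¬ u ∈ f → ¬ v ∈ f →
    CommonNonNeighbour (inj₁ u) (inj₁ v)
  disjointEdge⇒commonNonNeighbour f u∉f v∉f = inj₂ f , (λ ()) , (λ ()) , u∉f , v∉f

  outerNeighbour⇒commonNonNeighbour : ∀ {x c e} → x ~ c → ¬ c ∈ e →
    CommonNonNeighbour (inj₁ x) (inj₂ e)
  outerNeighbour⇒commonNonNeighbour {c = c} x~c c∉e =
    inj₁ c , (λ { refl → ~-irrefl x~c refl }) , (λ ()) , (λ (_ , x≁c) → x≁c x~c) , c∉e

  edgeMissingEndpoint⇒commonNonNeighbour : ∀ {x e} f → x ∈ e → ¬ x ∈ f →
    CommonNonNeighbour (inj₁ x) (inj₂ e)
  edgeMissingEndpoint⇒commonNonNeighbour f x∈e x∉f =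
    inj₂ f , (λ ()) , (λ { refl → x∉f x∈e }) , x∉f , λ ()

  nonadjacent⇒commonNonNeighbour : ∀ {u v} → u ≢ v → ¬ u ~ v → Star _~_ u v →
    CommonNonNeighbour (inj₁ u) (inj₁ v)
  nonadjacent⇒commonNonNeighbour {u} {v} u≢v u≁v = fromSource refl
    where
    fromSource : ∀ {s} → s ≡ u → Star _~_ s v → CommonNonNeighbour (inj₁ u) (inj₁ v)
    fromNeighbour : ∀ {a} → u ~ a → Star _~_ a v → CommonNonNeighbour (inj₁ u) (inj₁ v)

    fromSource v≡u ε = ⊥-elim (≢-sym u≢v v≡u)
    fromSource refl (u~a ◅ walk) = fromNeighbour u~a walk

    fromNeighbour u~v ε = ⊥-elim (u≁v u~v)
    fromNeighbour {a} u~a (_◅_ {j = b} a~b walk) with b ≟ u | b ≟ v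
    ... | yes b≡u | _ = fromSource b≡u walk
    ... | no _ | yes refl = commonNeighbour⇒commonNonNeighbour u~a (~-sym a~b)
    ... | no b≢u | no b≢v = disjointEdge⇒commonNonNeighbour (toEdge a~b)
      (∉-toEdge a~b (λ { refl → ~-irrefl u~a refl }) (≢-sym b≢u))
      (∉-toEdge a~b (λ { refl → u≁v u~a }) (≢-sym b≢v))

  endpoint⇒commonNonNeighbour : ∀ {x c e} → x ∈ e → ¬ c ∈ e → Star _~_ c x →
    CommonNonNeighbour (inj₁ x) (inj₂ e)
  endpoint⇒commonNonNeighbour x∈e c∉e ε = ⊥-elim (c∉e x∈e)
  endpoint⇒commonNonNeighbour {x} x∈e c∉e (_◅_ {j = d} c~d _) with d ≟ x
  ... | yes refl = outerNeighbour⇒commonNonNeighbour (~-sym c~d) c∉e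
  ... | no d≢x = edgeMissingEndpoint⇒commonNonNeighbour (toEdge c~d) x∈e
    (∉-toEdge c~d (λ { refl → c∉e x∈e }) (≢-sym d≢x))

  incident⇒commonNonNeighbour : ∀ {x e} → p ≥ 3 → Connected G → x ∈ e →
    CommonNonNeighbour (inj₁ x) (inj₂ e)
  incident⇒commonNonNeighbour {x} {e} p≥3 conn x∈e with outside p≥3 e
  ... | c , c∉e = endpoint⇒commonNonNeighbour x∈e c∉e (conn c x)

lemma3p5 : (p : ℕ) → p ≥ 3 → (G : Graph p) → Connected G →
    (u v : CVertex G) → CAdj G u v →
    Σ (CVertex G) λ w → w ≢ u × w ≢ v × ¬ CAdj G u w × ¬ CAdj G v w
lemma3p5 p p≥3 G conn (inj₁ u) (inj₁ v) (u≢v , u≁v) =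
  nonadjacent⇒commonNonNeighbour G u≢v u≁v (conn u v)
lemma3p5 p p≥3 G conn (inj₁ x) (inj₂ e) x∈e = incident⇒commonNonNeighbour G p≥3 conn x∈e
lemma3p5 p p≥3 G conn (inj₂ e) (inj₁ x) x∈e =
  commonNonNeighbour-sym G (incident⇒commonNonNeighbour G p≥3 conn x∈e)
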